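{- Let $m$ be a number and $p\ge0$ an integer such that the ball $[m,-\frac{1}{2^p}]$ is balanced. Then \[[m,-\tfrac{1}{2^p}]\mathbin{:}\underline{0}\triangleq[m,-\tfrac{1}{2^{p+1}}],\] and $[m,-\frac{1}{2^{p+1}}]$ is also balanced.
   Context: Games are short normal-play combinatorial games with the usual disjunctive sum, negation, order and equality. Numbers are games whose options are numbers with every Left option strictly less than every Right option; short number values are dyadic rationals. The ordinal sum is $G\mathbin{:}H\cong\{L(G),G\mathbin{:}H^L\mid R(G),G\mathbin{:}H^R\}$. $\underline{0}$ denotes $1+(-1)\cong\{ -1\mid1\}$ with canonical integers. For numbers $m,\Delta$, the ball $[m,\Delta]$ is the game $\{x\mid y\}$ where $x,y$ are the canonical forms of $m+\Delta$ and $m-\Delta$; it is balanced if $[m,\Delta]+[m,\Delta]=m+m$. $G\triangleq H$ (equivalence modulo domination) means that in $G+(-H)$, for every first move by either player in either summand, the other player has a winning response made in the other summand. -}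

module Defs where

open import Data.Nat as ℕ using (ℕ; zero; suc)
open import Data.Integer as ℤ using (ℤ; +_; -[1+_]; _/ℕ_; _%ℕ_)
open import Data.Fin using (Fin; splitAt)
open import Data.Fin.Patterns using (0F)
open import Data.Sum using ([_,_])
open import Data.Product using (Σ; _×_)

data Game : Set where
  mk : (nl : ℕ) → (Fin nl → Game) → (nr : ℕ) → (Fin nr → Game) → Game

⟨_∣_⟩ : Game → Game → Game
⟨ x ∣ y ⟩ = mk 1 (λ _ → x) 1 (λ _ → y)

-- Disjunctive sum  G + H = { G^L + H , G + H^L | G^R + H , G + H^R }
infixl 6 _⊕_
_⊕_ : Game → Game → Game
mk nl L nr R ⊕ mk ml L′ mr R′ =
  mk (nl ℕ.+ ml)
     (λ i → [ (λ a → L a ⊕ mk ml L′ mr R′) , (λ b → mk nl L nr R ⊕ L′ b) ] (splitAt nl i))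
     (nr ℕ.+ mr)
     (λ j → [ (λ a → R a ⊕ mk ml L′ mr R′) , (λ b → mk nl L nr R ⊕ R′ b) ] (splitAt nr j))

neg : Game → Game
neg (mk nl L nr R) = mk nr (λ j → neg (R j)) nl (λ i → neg (L i))

-- LWins₂ G : Left wins G when Right moves first (G ≥ 0)
-- LWins₁ G : Left wins G when Left moves first
-- RWins₂ G : Right wins G when Left moves first (G ≤ 0)
-- RWins₁ G : Right wins G when Right moves first

LWins₂ LWins₁ RWins₂ RWins₁ : Game → Set
LWins₂ (mk nl L nr R) = (j : Fin nr) → LWins₁ (R j)
LWins₁ (mk nl L nr R) = Σ (Fin nl) λ i → LWins₂ (L i)
RWins₂ (mk nl L nr R) = (i : Fin nl) → RWins₁ (L i)
RWins₁ (mk nl L nr R) = Σ (Fin nr) λ j → RWins₂ (R j)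

infix 4 _≤G_ _≈G_ _≜_
_≤G_ : Game → Game → Set
G ≤G H = LWins₂ (H ⊕ neg G)

_≈G_ : Game → Game → Set
G ≈G H = (G ≤G H) × (H ≤G G)

-- Ordinal sum  G : H = { G^L , G : H^L | G^R , G : H^R }

infixl 7 _∶_
_∶_ : Game → Game → Game
mk nl L nr R ∶ mk ml L′ mr R′ =
  mk (nl ℕ.+ ml)
     (λ i → [ L , (λ b → mk nl L nr R ∶ L′ b) ] (splitAt nl i))
     (nr ℕ.+ mr)
     (λ j → [ R , (λ b → mk nl L nr R ∶ R′ b) ] (splitAt nr j))

-- Equivalence modulo domination  G ≜ H : in G + (-H), every first move
-- by either player in either summand has a winning reply (the replier
-- then wins moving second) by the other player in the other summand.
-- (Left's options of -H are -(H^R), Right's options of -H are -(H^L).)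

_≜_ : Game → Game → Set
mk nl L nr R ≜ mk ml L′ mr R′ =
  -- Left moves in G to G^L; Right replies in -H to -(H^L)
  ((i : Fin nl) → Σ (Fin ml) λ k → RWins₂ (L i ⊕ neg (L′ k))) ×
  -- Left moves in -H to -(H^R); Right replies in G to G^R
  ((k : Fin mr) → Σ (Fin nr) λ j → RWins₂ (R j ⊕ neg (R′ k))) ×
  -- Right moves in G to G^R; Left replies in -H to -(H^R)
  ((j : Fin nr) → Σ (Fin mr) λ k → LWins₂ (R j ⊕ neg (R′ k))) ×
  -- Right moves in -H to -(H^L); Left replies in G to G^L
  ((k : Fin ml) → Σ (Fin nl) λ i → LWins₂ (L i ⊕ neg (L′ k)))

natG : ℕ → Game
natG zero    = mk 0 (λ ()) 0 (λ ())
natG (suc n) = mk 1 (λ _ → natG n) 0 (λ ())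

intG : ℤ → Game
intG (+ n)     = natG n
intG -[1+ n ]  = neg (natG (suc n))

record Dyadic : Set where
  constructor _/2^_
  field
    num : ℤ
    exp : ℕ
open Dyadic public

-- canonical form of a / 2^k:
--   k = 0 : the canonical integer a;
--   a even: canonical form of (a/2) / 2^(k-1);
--   a odd : { (a-1)/2^k | (a+1)/2^k }  (both written in lowest terms).
canonZ : ℤ → ℕ → Game
canonZ a zero    = intG a
canonZ a (suc k) with a %ℕ 2
... | zero  = canonZ (a /ℕ 2) k
... | suc _ = ⟨ canonZ (a /ℕ 2) k ∣ canonZ ((a /ℕ 2) ℤ.+ ℤ.1ℤ) k ⟩

canon : Dyadic → Game
canon (a /2^ k) = canonZ a k

_+D_ : Dyadic → Dyadic → Dyadic
(a /2^ k) +D (b /2^ l) = ((a ℤ.* (+ (2 ℕ.^ l))) ℤ.+ (b ℤ.* (+ (2 ℕ.^ k)))) /2^ (k ℕ.+ l)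

-D_ : Dyadic → Dyadic
-D (a /2^ k) = (ℤ.- a) /2^ k

_-D_ : Dyadic → Dyadic → Dyadic
x -D y = x +D (-D y)

ball : Dyadic → Dyadic → Game
ball m Δ = ⟨ canon (m +D Δ) ∣ canon (m -D Δ) ⟩

Balanced : Dyadic → Dyadic → Set
Balanced m Δ = (ball m Δ ⊕ ball m Δ) ≈G (canon m ⊕ canon m)

negPow : ℕ → Dyadic
negPow p = ℤ.-1ℤ /2^ p

zeroU : Game
zeroU = ⟨ intG ℤ.-1ℤ ∣ intG ℤ.1ℤ ⟩

{-# OPTIONS --safe #-}

-- Write m = a/2^k.  If k ≤ p then m = b/2^p lies on the grid 2^-p ℤ; with ℓ, μ, ρ the
-- canonical forms of (b-1)/2^p, b/2^p, (b+1)/2^p the two balls are {ℓ | ρ} and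
-- {{ℓ | μ} | {μ | ρ}}.  Balance gives {ℓ | ρ} = μ, since for numbers G + G = H + H forces
-- G = H.  Then the options ℓ and {ℓ | ρ} : -1 of {ℓ | ρ} : 0 are matched by {ℓ | μ}, the
-- options ρ and {ℓ | ρ} : 1 by {μ | ρ}, and {{ℓ | μ} | {μ | ρ}} = μ because every option
-- of μ lies outside the open interval (ℓ, ρ).
-- If k > p with a odd, then m = {X | Y} with X = m - 2^-k above the left end m - 2^-p of
-- the ball, and the ball cannot equal m: m ≤ ball needs X ≤ m - 2^-p, or some right
-- option of X, all of which are ≥ Y, to lie below the ball and hence below m.

module Submission where

open import Defs
open import Data.Nat using (ℕ; suc)
open import Data.Product using (_×_)

open import Data.Nat as ℕ using (zero; _^_; z≤n; s≤s)
import Data.Nat.Properties as ℕ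
open import Data.Integer as ℤ using (ℤ; +_; -[1+_]; _/ℕ_; _%ℕ_; 1ℤ; -1ℤ)
open import Data.Integer.DivMod using (a≡a%ℕn+[a/ℕn]*n; n%ℕd<d)
import Data.Nat.DivMod as ℕ
import Data.Integer.Properties as ℤ
open import Algebra.Properties.CommutativeSemigroup ℤ.*-commutativeSemigroup using (xy∙z≈xz∙y)
open import Data.Integer.Tactic.RingSolver using (solve; solve-∀)
open import Data.Fin using (Fin; splitAt; _↑ˡ_; _↑ʳ_)
open import Data.Fin.Patterns using (0F; 1F)
open import Data.Fin.Properties using (splitAt-↑ˡ; splitAt-↑ʳ)
open import Data.Vec.Functional using (Vector; _++_)
open import Data.Vec.Functional.Relation.Unary.All using (All)
open import Data.Vec.Functional.Relation.Unary.Any using (Any)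
open import Data.Vec.Functional.Relation.Unary.All.Properties
  using () renaming (++⁺ to all-++⁺; ++⁻ˡ to all-++⁻ˡ; ++⁻ʳ to all-++⁻ʳ)
open import Data.List using (_∷_; [])
open import Data.Product using (∃; _,_; proj₁; proj₂; map₂)
import Data.Sum as Sum
open import Data.Sum using (_⊎_; inj₁; inj₂; [_,_]; swap)
open import Data.Empty using (⊥-elim)
open import Relation.Nullary using (¬_; yes; no)
open import Relation.Binary.PropositionalEquality
  using (_≡_; refl; sym; trans; cong; cong₂; subst; subst₂; module ≡-Reasoning)

module _ {A : Set} (P : A → Set) {m n : ℕ} (xs : Vector A m) (ys : Vector A n) where

  any-++⁺ˡ : ∀ i → P (xs i) → Any P (xs ++ ys)
  any-++⁺ˡ i p = i ↑ˡ n , subst P (cong [ xs , ys ] (sym (splitAt-↑ˡ m i n))) p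

  any-++⁺ʳ : ∀ j → P (ys j) → Any P (xs ++ ys)
  any-++⁺ʳ j p = m ↑ʳ j , subst P (cong [ xs , ys ] (sym (splitAt-↑ʳ m n j))) p

  any-++⁻ : Any P (xs ++ ys) → Any P xs ⊎ Any P ys
  any-++⁻ (k , p) with splitAt m k
  ... | inj₁ i = inj₁ (i , p)
  ... | inj₂ j = inj₂ (j , p)

all⊎any : ∀ n {P Q : Fin n → Set} → (∀ i → P i ⊎ Q i) → (∀ i → P i) ⊎ ∃ Q
all⊎any zero      pq = inj₁ λ ()
all⊎any (suc n) pq with pq 0F | all⊎any n (λ i → pq (Fin.suc i))
... | inj₂ q | _            = inj₂ (0F , q)
... | inj₁ _ | inj₂ (i , q) = inj₂ (Fin.suc i , q)
... | inj₁ p | inj₁ ps      = inj₁ λ { 0F → p ; (Fin.suc i) → ps i }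

-- Conway's order

nL nR : Game → ℕ
nL (mk n _ _ _) = n
nR (mk _ _ n _) = n

Lo : (G : Game) → Vector Game (nL G)
Lo (mk _ L _ _) = L

Ro : (G : Game) → Vector Game (nR G)
Ro (mk _ _ _ R) = R

-- G ⧏ H ("G is less than or confused with H") is the positive form of ¬ (H ≤ G).
infix 4 _≤_ _⧏_
_≤_ _⧏_ : Game → Game → Set
G@(mk _ L _ _) ≤ H@(mk _ _ _ R) = (∀ i → L i ⧏ H) × (∀ j → G ⧏ R j)
G@(mk _ _ _ R) ⧏ H@(mk _ L _ _) = (∃ λ i → G ≤ L i) ⊎ (∃ λ j → R j ≤ H)

≤-intro : ∀ G H → All (_⧏ H) (Lo G) → All (G ⧏_) (Ro H) → G ≤ H
≤-intro (mk _ _ _ _) (mk _ _ _ _) l r = l , r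

≤⇒Lo⧏ : ∀ {G H} → G ≤ H → All (_⧏ H) (Lo G)
≤⇒Lo⧏ {mk _ _ _ _} {mk _ _ _ _} = proj₁

≤⇒⧏Ro : ∀ {G H} → G ≤ H → All (G ⧏_) (Ro H)
≤⇒⧏Ro {mk _ _ _ _} {mk _ _ _ _} = proj₂

≤Lo⇒⧏ : ∀ {G} H → Any (G ≤_) (Lo H) → G ⧏ H
≤Lo⇒⧏ {mk _ _ _ _} (mk _ _ _ _) = inj₁

Ro≤⇒⧏ : ∀ G {H} → Any (_≤ H) (Ro G) → G ⧏ H
Ro≤⇒⧏ (mk _ _ _ _) {mk _ _ _ _} = inj₂

≤-refl : ∀ G → G ≤ G
≤-refl G@(mk _ L _ R) = (λ i → ≤Lo⇒⧏ G (i , ≤-refl (L i))) , (λ j → Ro≤⇒⧏ G (j , ≤-refl (R j)))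

≤-trans : ∀ {G H K} → G ≤ H → H ≤ K → G ≤ K
⧏-≤-trans : ∀ {G H K} → G ⧏ H → H ≤ K → G ⧏ K
≤-⧏-trans : ∀ {G H K} → G ≤ H → H ⧏ K → G ⧏ K
≤-trans {mk _ _ _ _} {mk _ _ _ _} {mk _ _ _ _} G≤H@(L⧏H , _) H≤K@(_ , H⧏R) =
  (λ i → ⧏-≤-trans (L⧏H i) H≤K) , (λ j → ≤-⧏-trans G≤H (H⧏R j))
⧏-≤-trans {mk _ _ _ _} {mk _ _ _ _} {mk _ _ _ _} (inj₁ (i , G≤Li)) (L⧏K , _) = ≤-⧏-trans G≤Li (L⧏K i)
⧏-≤-trans {mk _ _ _ _} {mk _ _ _ _} {mk _ _ _ _} (inj₂ (j , Rj≤H)) H≤K = inj₂ (j , ≤-trans Rj≤H H≤K)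
≤-⧏-trans {mk _ _ _ _} {mk _ _ _ _} {mk _ _ _ _} G≤H (inj₁ (i , H≤Li)) = inj₁ (i , ≤-trans G≤H H≤Li)
≤-⧏-trans {mk _ _ _ _} {mk _ _ _ _} {mk _ _ _ _} (_ , G⧏R) (inj₂ (j , Rj≤K)) = ⧏-≤-trans (G⧏R j) Rj≤K

⧏-irrefl : ∀ G → ¬ (G ⧏ G)
⧏-irrefl (mk _ L _ _) (inj₁ (i , G≤Li)) = ⧏-irrefl (L i) (≤⇒Lo⧏ G≤Li i)
⧏-irrefl (mk _ _ _ R) (inj₂ (j , Rj≤G)) = ⧏-irrefl (R j) (≤⇒⧏Ro Rj≤G j)

infix 4 _≈_
_≈_ : Game → Game → Set
G ≈ H = G ≤ H × H ≤ G

≤⊎⧏ : ∀ G H → G ≤ H ⊎ H ⧏ G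
⧏⊎≤ : ∀ G H → G ⧏ H ⊎ H ≤ G
≤⊎⧏ G@(mk nl L _ _) H@(mk _ _ nr R)
  with all⊎any nl (λ i → ⧏⊎≤ (L i) H) | all⊎any nr (λ j → ⧏⊎≤ G (R j))
... | inj₂ H≤L | _        = inj₂ (≤Lo⇒⧏ G H≤L)
... | inj₁ _   | inj₂ R≤G = inj₂ (Ro≤⇒⧏ H R≤G)
... | inj₁ L⧏H | inj₁ G⧏R = inj₁ (L⧏H , G⧏R)
⧏⊎≤ G@(mk _ _ nr R) H@(mk nl L _ _)
  with all⊎any nl (λ i → swap (≤⊎⧏ G (L i))) | all⊎any nr (λ j → swap (≤⊎⧏ (R j) H))
... | inj₂ G≤L | _        = inj₁ (≤Lo⇒⧏ H G≤L)
... | inj₁ _   | inj₂ R≤H = inj₁ (Ro≤⇒⧏ G R≤H)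
... | inj₁ L⧏G | inj₁ H⧏R = inj₂ (L⧏G , H⧏R)

-- Outcomes and sums

≤⇒LWins₂ : ∀ G H → G ≤ H → LWins₂ (H ⊕ neg G)
⧏⇒LWins₁ : ∀ G H → G ⧏ H → LWins₁ (H ⊕ neg G)
≤⇒LWins₂ G@(mk _ L _ _) H@(mk _ _ _ R) (L⧏H , G⧏R) =
  all-++⁺ LWins₁ (λ j → ⧏⇒LWins₁ G (R j) (G⧏R j)) (λ i → ⧏⇒LWins₁ (L i) H (L⧏H i))
⧏⇒LWins₁ G@(mk _ _ _ R) H@(mk _ L _ _) (inj₁ (i , G≤Li)) =
  any-++⁺ˡ LWins₂ _ _ i (≤⇒LWins₂ G (L i) G≤Li)
⧏⇒LWins₁ G@(mk _ _ _ R) H@(mk _ L _ _) (inj₂ (j , Rj≤H)) =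
  any-++⁺ʳ LWins₂ _ _ j (≤⇒LWins₂ (R j) H Rj≤H)

LWins₂⇒≤ : ∀ G H → LWins₂ (H ⊕ neg G) → G ≤ H
LWins₁⇒⧏ : ∀ G H → LWins₁ (H ⊕ neg G) → G ⧏ H
LWins₂⇒≤ G@(mk _ L _ _) H@(mk _ _ _ R) w =
    (λ i → LWins₁⇒⧏ (L i) H (all-++⁻ʳ LWins₁ _ w i))
  , (λ j → LWins₁⇒⧏ G (R j) (all-++⁻ˡ LWins₁ _ w j))
LWins₁⇒⧏ G@(mk _ _ _ R) H@(mk _ L _ _) w =
  Sum.map (map₂ λ {i} → LWins₂⇒≤ G (L i)) (map₂ λ {j} → LWins₂⇒≤ (R j) H) (any-++⁻ LWins₂ _ _ w)

≤⇒RWins₂ : ∀ G H → G ≤ H → RWins₂ (G ⊕ neg H)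
⧏⇒RWins₁ : ∀ G H → G ⧏ H → RWins₁ (G ⊕ neg H)
≤⇒RWins₂ G@(mk _ L _ _) H@(mk _ _ _ R) (L⧏H , G⧏R) =
  all-++⁺ RWins₁ (λ i → ⧏⇒RWins₁ (L i) H (L⧏H i)) (λ j → ⧏⇒RWins₁ G (R j) (G⧏R j))
⧏⇒RWins₁ G@(mk _ _ _ R) H@(mk _ L _ _) (inj₁ (i , G≤Li)) =
  any-++⁺ʳ RWins₂ _ _ i (≤⇒RWins₂ G (L i) G≤Li)
⧏⇒RWins₁ G@(mk _ _ _ R) H@(mk _ L _ _) (inj₂ (j , Rj≤H)) =
  any-++⁺ˡ RWins₂ _ _ j (≤⇒RWins₂ (R j) H Rj≤H)

⊕-monoˡ-≤ : ∀ G H K → G ≤ H → G ⊕ K ≤ H ⊕ K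
⊕-monoˡ-⧏ : ∀ G H K → G ⧏ H → G ⊕ K ⧏ H ⊕ K
⊕-monoˡ-≤ G@(mk _ L _ _) H@(mk _ _ _ R) K@(mk _ Lk _ Rk) G≤H@(L⧏H , G⧏R) =
    all-++⁺ (_⧏ H ⊕ K)
      (λ i → ⊕-monoˡ-⧏ (L i) H K (L⧏H i))
      (λ i → ≤Lo⇒⧏ (H ⊕ K) (any-++⁺ʳ (G ⊕ Lk i ≤_) _ _ i (⊕-monoˡ-≤ G H (Lk i) G≤H)))
  , all-++⁺ (G ⊕ K ⧏_)
      (λ j → ⊕-monoˡ-⧏ G (R j) K (G⧏R j))
      (λ j → Ro≤⇒⧏ (G ⊕ K) (any-++⁺ʳ (_≤ H ⊕ Rk j) _ _ j (⊕-monoˡ-≤ G H (Rk j) G≤H)))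
⊕-monoˡ-⧏ G@(mk _ _ _ R) H@(mk _ L _ _) K@(mk _ _ _ _) (inj₁ (i , G≤Li)) =
  ≤Lo⇒⧏ (H ⊕ K) (any-++⁺ˡ (G ⊕ K ≤_) _ _ i (⊕-monoˡ-≤ G (L i) K G≤Li))
⊕-monoˡ-⧏ G@(mk _ _ _ R) H@(mk _ L _ _) K@(mk _ _ _ _) (inj₂ (j , Rj≤H)) =
  Ro≤⇒⧏ (G ⊕ K) (any-++⁺ˡ (_≤ H ⊕ K) _ _ j (⊕-monoˡ-≤ (R j) H K Rj≤H))

⊕-monoʳ-≤ : ∀ K G H → G ≤ H → K ⊕ G ≤ K ⊕ H
⊕-monoʳ-⧏ : ∀ K G H → G ⧏ H → K ⊕ G ⧏ K ⊕ H
⊕-monoʳ-≤ K@(mk _ Lk _ Rk) G@(mk _ L _ _) H@(mk _ _ _ R) G≤H@(L⧏H , G⧏R) =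
    all-++⁺ (_⧏ K ⊕ H)
      (λ i → ≤Lo⇒⧏ (K ⊕ H) (any-++⁺ˡ (Lk i ⊕ G ≤_) _ _ i (⊕-monoʳ-≤ (Lk i) G H G≤H)))
      (λ i → ⊕-monoʳ-⧏ K (L i) H (L⧏H i))
  , all-++⁺ (K ⊕ G ⧏_)
      (λ j → Ro≤⇒⧏ (K ⊕ G) (any-++⁺ˡ (_≤ Rk j ⊕ H) _ _ j (⊕-monoʳ-≤ (Rk j) G H G≤H)))
      (λ j → ⊕-monoʳ-⧏ K G (R j) (G⧏R j))
⊕-monoʳ-⧏ K@(mk _ _ _ _) G@(mk _ _ _ R) H@(mk _ L _ _) (inj₁ (i , G≤Li)) =
  ≤Lo⇒⧏ (K ⊕ H) (any-++⁺ʳ (K ⊕ G ≤_) _ _ i (⊕-monoʳ-≤ K G (L i) G≤Li))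
⊕-monoʳ-⧏ K@(mk _ _ _ _) G@(mk _ _ _ R) H@(mk _ L _ _) (inj₂ (j , Rj≤H)) =
  Ro≤⇒⧏ (K ⊕ G) (any-++⁺ʳ (_≤ K ⊕ H) _ _ j (⊕-monoʳ-≤ K (R j) H Rj≤H))

-- Numbers

IsNumber : Game → Set
IsNumber (mk _ L _ R) = (∀ i → IsNumber (L i)) × (∀ j → IsNumber (R j)) × (∀ i j → L i ⧏ R j)

Lo≤number : ∀ G → IsNumber G → ∀ i → Lo G i ≤ G
Lo≤number G@(mk _ L _ R) (isL , _ , L⧏R) i =
  ≤-intro (L i) G (λ i′ → ≤Lo⇒⧏ G (i , Lo≤number (L i) (isL i) i′)) (L⧏R i)

number≤Ro : ∀ G → IsNumber G → ∀ j → G ≤ Ro G j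
number≤Ro G@(mk _ L _ R) (_ , isR , L⧏R) j =
  ≤-intro G (R j) (λ i → L⧏R i j) (λ j′ → Ro≤⇒⧏ G (j , number≤Ro (R j) (isR j) j′))

number-⧏⇒≤ : ∀ {G H} → IsNumber G → IsNumber H → G ⧏ H → G ≤ H
number-⧏⇒≤ {G@(mk _ _ _ _)} {H@(mk _ _ _ _)} _ isH (inj₁ (i , G≤Li)) = ≤-trans G≤Li (Lo≤number H isH i)
number-⧏⇒≤ {G@(mk _ _ _ _)} {H@(mk _ _ _ _)} isG _ (inj₂ (j , Rj≤H)) = ≤-trans (number≤Ro G isG j) Rj≤H

⟨∣⟩-isNumber : ∀ {x y} → IsNumber x → IsNumber y → x ⧏ y → IsNumber ⟨ x ∣ y ⟩
⟨∣⟩-isNumber isX isY x⧏y = (λ _ → isX) , (λ _ → isY) , (λ _ _ → x⧏y)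

double-cancel-≤ : ∀ G H → IsNumber G → IsNumber H → G ⊕ G ≤ H ⊕ H → G ≤ H
double-cancel-≤ G H isG isH GG≤HH with ≤⊎⧏ G H
... | inj₁ G≤H = G≤H
... | inj₂ H⧏G = ⊥-elim (⧏-irrefl (H ⊕ H)
      (⧏-≤-trans (⊕-monoˡ-⧏ H G H H⧏G)
        (≤-trans (⊕-monoʳ-≤ G H G (number-⧏⇒≤ isH isG H⧏G)) GG≤HH)))

BalancedAt : Game → Game → Set
BalancedAt B μ = (B ⊕ B) ≈G (μ ⊕ μ)

balanced⇒≈ : ∀ B μ → IsNumber B → IsNumber μ → BalancedAt B μ → B ≈ μ
balanced⇒≈ B μ isB isμ (BB≤μμ , μμ≤BB) =
    double-cancel-≤ B μ isB isμ (LWins₂⇒≤ (B ⊕ B) (μ ⊕ μ) BB≤μμ)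
  , double-cancel-≤ μ B isμ isB (LWins₂⇒≤ (μ ⊕ μ) (B ⊕ B) μμ≤BB)

≈⇒balanced : ∀ B μ → B ≈ μ → BalancedAt B μ
≈⇒balanced B μ (B≤μ , μ≤B) =
    ≤⇒LWins₂ (B ⊕ B) (μ ⊕ μ) (≤-trans (⊕-monoˡ-≤ B μ B B≤μ) (⊕-monoʳ-≤ μ B μ B≤μ))
  , ≤⇒LWins₂ (μ ⊕ μ) (B ⊕ B) (≤-trans (⊕-monoˡ-≤ μ B μ μ≤B) (⊕-monoʳ-≤ B μ B μ≤B))

-- Ordinal sums and the halving of a ball

-- mk 0 f 0 g covers both natG 0 and neg (natG 0), the zeros inside intG 1ℤ and intG -1ℤ.
∶-zeroʳ-≤ : ∀ G {f g} → G ∶ mk 0 f 0 g ≤ G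
∶-zeroʳ-≤ G@(mk _ L _ R) =
    all-++⁺ (_⧏ G) (λ i → ≤Lo⇒⧏ G (i , ≤-refl (L i))) (λ ())
  , (λ j → Ro≤⇒⧏ (G ∶ _) (any-++⁺ˡ (_≤ R j) R _ j (≤-refl (R j))))

≤-∶-zeroʳ : ∀ G {f g} → G ≤ G ∶ mk 0 f 0 g
≤-∶-zeroʳ G@(mk _ L _ R) =
    (λ i → ≤Lo⇒⧏ (G ∶ _) (any-++⁺ˡ (L i ≤_) L _ i (≤-refl (L i))))
  , all-++⁺ (G ⧏_) (λ j → Ro≤⇒⧏ G (j , ≤-refl (R j))) (λ ())

module _ (ℓ μ ρ : Game) (G≈μ : ⟨ ℓ ∣ ρ ⟩ ≈ μ) where
  private
    G = ⟨ ℓ ∣ ρ ⟩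
    G≤μ = proj₁ G≈μ
    μ≤G = proj₂ G≈μ

  ∶-1≈lowerHalf : μ ≤ ρ → G ∶ intG -1ℤ ≈ ⟨ ℓ ∣ μ ⟩
  ∶-1≈lowerHalf μ≤ρ =
      ( (λ { 0F → ≤Lo⇒⧏ ⟨ ℓ ∣ μ ⟩ (0F , ≤-refl ℓ) })
      , (λ _ → Ro≤⇒⧏ (G ∶ intG -1ℤ) (1F , ≤-trans (∶-zeroʳ-≤ G) G≤μ)) )
    , ( (λ _ → ≤Lo⇒⧏ (G ∶ intG -1ℤ) (0F , ≤-refl ℓ))
      , (λ { 0F → Ro≤⇒⧏ ⟨ ℓ ∣ μ ⟩ (0F , μ≤ρ)
           ; 1F → Ro≤⇒⧏ ⟨ ℓ ∣ μ ⟩ (0F , ≤-trans μ≤G (≤-∶-zeroʳ G)) }) )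

  ∶+1≈upperHalf : ℓ ≤ μ → G ∶ intG 1ℤ ≈ ⟨ μ ∣ ρ ⟩
  ∶+1≈upperHalf ℓ≤μ =
      ( (λ { 0F → ≤Lo⇒⧏ ⟨ μ ∣ ρ ⟩ (0F , ℓ≤μ)
           ; 1F → ≤Lo⇒⧏ ⟨ μ ∣ ρ ⟩ (0F , ≤-trans (∶-zeroʳ-≤ G) G≤μ) })
      , (λ _ → Ro≤⇒⧏ (G ∶ intG 1ℤ) (0F , ≤-refl ρ)) )
    , ( (λ _ → ≤Lo⇒⧏ (G ∶ intG 1ℤ) (1F , ≤-trans μ≤G (≤-∶-zeroʳ G)))
      , (λ { 0F → Ro≤⇒⧏ ⟨ μ ∣ ρ ⟩ (0F , ≤-refl ρ) }) )

HalvingStep : Game → Game → Game → Set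
HalvingStep G H μ = BalancedAt G μ → ((G ∶ zeroU) ≜ H) × BalancedAt H μ

module _ {ℓ μ ρ : Game} (isℓ : IsNumber ℓ) (isμ : IsNumber μ) (isρ : IsNumber ρ)
         (ℓ⧏μ : ℓ ⧏ μ) (μ⧏ρ : μ ⧏ ρ) where
  private
    isLower = ⟨∣⟩-isNumber isℓ isμ ℓ⧏μ
    isUpper = ⟨∣⟩-isNumber isμ isρ μ⧏ρ

  halves≈centre : (∀ i → Lo μ i ≤ ℓ) → (∀ j → ρ ≤ Ro μ j) → ⟨ ⟨ ℓ ∣ μ ⟩ ∣ ⟨ μ ∣ ρ ⟩ ⟩ ≈ μ
  halves≈centre Lo≤ℓ ρ≤Ro =
      ≤-intro H μ (λ _ → Ro≤⇒⧏ ⟨ ℓ ∣ μ ⟩ (0F , ≤-refl μ))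
                  (λ j → Ro≤⇒⧏ H (0F , ≤-trans (number≤Ro ⟨ μ ∣ ρ ⟩ isUpper 0F) (ρ≤Ro j)))
    , ≤-intro μ H (λ i → ≤Lo⇒⧏ H (0F , ≤-trans (Lo≤ℓ i) (Lo≤number ⟨ ℓ ∣ μ ⟩ isLower 0F)))
                  (λ _ → ≤Lo⇒⧏ ⟨ μ ∣ ρ ⟩ (0F , ≤-refl μ))
    where H = ⟨ ⟨ ℓ ∣ μ ⟩ ∣ ⟨ μ ∣ ρ ⟩ ⟩

  halves-≜ : ⟨ ℓ ∣ ρ ⟩ ≈ μ → (⟨ ℓ ∣ ρ ⟩ ∶ zeroU) ≜ ⟨ ⟨ ℓ ∣ μ ⟩ ∣ ⟨ μ ∣ ρ ⟩ ⟩
  halves-≜ G≈μ =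
      (λ { 0F → 0F , ≤⇒RWins₂ _ _ (Lo≤number ⟨ ℓ ∣ μ ⟩ isLower 0F)
         ; 1F → 0F , ≤⇒RWins₂ _ _ (proj₁ lower) })
    , (λ _ → 1F , ≤⇒RWins₂ _ _ (proj₁ upper))
    , (λ { 0F → 0F , ≤⇒LWins₂ _ _ (number≤Ro ⟨ μ ∣ ρ ⟩ isUpper 0F)
         ; 1F → 0F , ≤⇒LWins₂ _ _ (proj₂ upper) })
    , (λ _ → 1F , ≤⇒LWins₂ _ _ (proj₂ lower))
    where
    lower = ∶-1≈lowerHalf ℓ μ ρ G≈μ (number-⧏⇒≤ isμ isρ μ⧏ρ)
    upper = ∶+1≈upperHalf ℓ μ ρ G≈μ (number-⧏⇒≤ isℓ isμ ℓ⧏μ)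

  split-ball : (∀ i → Lo μ i ≤ ℓ) → (∀ j → ρ ≤ Ro μ j) →
    HalvingStep ⟨ ℓ ∣ ρ ⟩ ⟨ ⟨ ℓ ∣ μ ⟩ ∣ ⟨ μ ∣ ρ ⟩ ⟩ μ
  split-ball Lo≤ℓ ρ≤Ro balanced =
    halves-≜ (balanced⇒≈ _ μ isBall isμ balanced) , ≈⇒balanced _ μ (halves≈centre Lo≤ℓ ρ≤Ro)
    where isBall = ⟨∣⟩-isNumber isℓ isρ (⧏-≤-trans ℓ⧏μ (number-⧏⇒≤ isμ isρ μ⧏ρ))

off-centre : ∀ {X Y gA gB} → gA ⧏ X → (∀ j → Y ≤ Ro X j) → ¬ (⟨ gA ∣ gB ⟩ ≈ ⟨ X ∣ Y ⟩)
off-centre {X@(mk _ _ _ _)} {Y} {gA} gA⧏X Y≤Ro (G≤μ , μ≤G) with ≤⇒Lo⧏ μ≤G 0F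
... | inj₁ (_ , X≤gA)  = ⧏-irrefl gA (⧏-≤-trans gA⧏X X≤gA)
... | inj₂ (j , Roj≤G) = ⧏-irrefl ⟨ X ∣ Y ⟩ (Ro≤⇒⧏ ⟨ X ∣ Y ⟩ (0F , ≤-trans (Y≤Ro j) (≤-trans Roj≤G G≤μ)))

-- Canonical forms

[w*2]%ℕ2≡0 : ∀ w → (w ℤ.* + 2) %ℕ 2 ≡ 0
[w*2]%ℕ2≡0 (+ n) rewrite ℤ.+◃n≡+n (n ℕ.* 2) = ℕ.m*n%n≡0 n 2
[w*2]%ℕ2≡0 -[1+ n ] with suc (suc (n ℕ.* 2)) ℕ.% 2 | ℕ.m*n%n≡0 (suc n) 2
... | zero | _ = refl

[w*2]/ℕ2≡w : ∀ w → (w ℤ.* + 2) /ℕ 2 ≡ w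
[w*2]/ℕ2≡w (+ n) rewrite ℤ.+◃n≡+n (n ℕ.* 2) = cong +_ (ℕ.m*n/n≡m n 2)
[w*2]/ℕ2≡w -[1+ n ] with suc (suc (n ℕ.* 2)) ℕ.% 2 | ℕ.m*n%n≡0 (suc n) 2
... | zero | _ = cong (λ k → ℤ.- (+ k)) (ℕ.m*n/n≡m (suc n) 2)

[1+n*2]/2≡n : ∀ n → suc (n ℕ.* 2) ℕ./ 2 ≡ n
[1+n*2]/2≡n zero    = refl
[1+n*2]/2≡n (suc n) = trans (ℕ.m/n≡1+[m∸n]/n {suc (suc (suc (n ℕ.* 2)))} {2} (s≤s (s≤s z≤n)))
                            (cong suc ([1+n*2]/2≡n n))

[w*2+1]%ℕ2≡1 : ∀ w → (w ℤ.* + 2 ℤ.+ 1ℤ) %ℕ 2 ≡ 1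
[w*2+1]%ℕ2≡1 (+ n) rewrite ℤ.+◃n≡+n (n ℕ.* 2) | ℕ.+-comm (n ℕ.* 2) 1 = ℕ.[m+kn]%n≡m%n 1 n 2
[w*2+1]%ℕ2≡1 -[1+ n ] with suc (n ℕ.* 2) ℕ.% 2 | ℕ.[m+kn]%n≡m%n 1 n 2
... | .1 | refl = refl

[w*2+1]/ℕ2≡w : ∀ w → (w ℤ.* + 2 ℤ.+ 1ℤ) /ℕ 2 ≡ w
[w*2+1]/ℕ2≡w (+ n) rewrite ℤ.+◃n≡+n (n ℕ.* 2) | ℕ.+-comm (n ℕ.* 2) 1 = cong +_ ([1+n*2]/2≡n n)
[w*2+1]/ℕ2≡w -[1+ n ] with suc (n ℕ.* 2) ℕ.% 2 | ℕ.[m+kn]%n≡m%n 1 n 2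
... | .1 | refl = cong -[1+_] ([1+n*2]/2≡n n)

data Parity : ℤ → Set where
  even : ∀ w → Parity (w ℤ.* + 2)
  odd  : ∀ w → Parity (w ℤ.* + 2 ℤ.+ 1ℤ)

parity : ∀ u → Parity u
parity u with u %ℕ 2 | a≡a%ℕn+[a/ℕn]*n u 2 | n%ℕd<d u 2
... | zero        | u≡ | _ = subst Parity (sym (trans u≡ (ℤ.+-identityˡ ((u /ℕ 2) ℤ.* + 2)))) (even (u /ℕ 2))
... | suc zero    | u≡ | _ = subst Parity (sym (trans u≡ (ℤ.+-comm 1ℤ ((u /ℕ 2) ℤ.* + 2)))) (odd (u /ℕ 2))
... | suc (suc _) | _  | s≤s (s≤s ())

canonZ-even : ∀ w K → canonZ (w ℤ.* + 2) (suc K) ≡ canonZ w K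
canonZ-even w K with (w ℤ.* + 2) %ℕ 2 | [w*2]%ℕ2≡0 w
... | zero | _ = cong (λ x → canonZ x K) ([w*2]/ℕ2≡w w)

canonZ-odd : ∀ w K → canonZ (w ℤ.* + 2 ℤ.+ 1ℤ) (suc K) ≡ ⟨ canonZ w K ∣ canonZ (w ℤ.+ 1ℤ) K ⟩
canonZ-odd w K with (w ℤ.* + 2 ℤ.+ 1ℤ) %ℕ 2 | [w*2+1]%ℕ2≡1 w
... | suc _ | _ = cong (λ x → ⟨ canonZ x K ∣ canonZ (x ℤ.+ 1ℤ) K ⟩) ([w*2+1]/ℕ2≡w w)

w*2+1+1≡[w+1]*2 : ∀ w → w ℤ.* + 2 ℤ.+ 1ℤ ℤ.+ 1ℤ ≡ (w ℤ.+ 1ℤ) ℤ.* + 2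
w*2+1+1≡[w+1]*2 = solve-∀

w*2+1-1≡w*2 : ∀ w → w ℤ.* + 2 ℤ.+ 1ℤ ℤ.+ -1ℤ ≡ w ℤ.* + 2
w*2+1-1≡w*2 = solve-∀

w*2-1≡[w-1]*2+1 : ∀ w → w ℤ.* + 2 ℤ.+ -1ℤ ≡ (w ℤ.+ -1ℤ) ℤ.* + 2 ℤ.+ 1ℤ
w*2-1≡[w-1]*2+1 = solve-∀

w-1+1≡w : ∀ w → w ℤ.+ -1ℤ ℤ.+ 1ℤ ≡ w
w-1+1≡w = solve-∀

canonZ-odd+1 : ∀ w K → canonZ (w ℤ.* + 2 ℤ.+ 1ℤ ℤ.+ 1ℤ) (suc K) ≡ canonZ (w ℤ.+ 1ℤ) K
canonZ-odd+1 w K =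
  trans (cong (λ x → canonZ x (suc K)) (w*2+1+1≡[w+1]*2 w)) (canonZ-even (w ℤ.+ 1ℤ) K)

canonZ-odd-1 : ∀ w K → canonZ (w ℤ.* + 2 ℤ.+ 1ℤ ℤ.+ -1ℤ) (suc K) ≡ canonZ w K
canonZ-odd-1 w K =
  trans (cong (λ x → canonZ x (suc K)) (w*2+1-1≡w*2 w)) (canonZ-even w K)

canonZ-even-1 : ∀ w K → canonZ (w ℤ.* + 2 ℤ.+ -1ℤ) (suc K) ≡ ⟨ canonZ (w ℤ.+ -1ℤ) K ∣ canonZ w K ⟩
canonZ-even-1 w K = begin
  canonZ (w ℤ.* + 2 ℤ.+ -1ℤ) (suc K)
    ≡⟨ cong (λ x → canonZ x (suc K)) (w*2-1≡[w-1]*2+1 w) ⟩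
  canonZ ((w ℤ.+ -1ℤ) ℤ.* + 2 ℤ.+ 1ℤ) (suc K)
    ≡⟨ canonZ-odd (w ℤ.+ -1ℤ) K ⟩
  ⟨ canonZ (w ℤ.+ -1ℤ) K ∣ canonZ (w ℤ.+ -1ℤ ℤ.+ 1ℤ) K ⟩
    ≡⟨ cong (λ x → ⟨ canonZ (w ℤ.+ -1ℤ) K ∣ canonZ x K ⟩) (w-1+1≡w w) ⟩
  ⟨ canonZ (w ℤ.+ -1ℤ) K ∣ canonZ w K ⟩ ∎
  where open ≡-Reasoning

canonZ-⧏-suc : ∀ K u → canonZ u K ⧏ canonZ (u ℤ.+ 1ℤ) K
canonZ-⧏-suc zero (+ n) rewrite ℕ.+-comm n 1 = ≤Lo⇒⧏ (natG (suc n)) (0F , ≤-refl (natG n))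
canonZ-⧏-suc zero -[1+ zero ]  = Ro≤⇒⧏ (intG -1ℤ) (0F , (λ ()) , (λ ()))
canonZ-⧏-suc zero -[1+ suc n ] = Ro≤⇒⧏ (intG -[1+ suc n ]) (0F , ≤-refl _)
canonZ-⧏-suc (suc K) u with parity u
... | even w rewrite canonZ-even w K | canonZ-odd w K = ≤Lo⇒⧏ _ (0F , ≤-refl (canonZ w K))
... | odd w rewrite canonZ-odd w K | canonZ-odd+1 w K = Ro≤⇒⧏ _ (0F , ≤-refl (canonZ (w ℤ.+ 1ℤ) K))

natG-isNumber : ∀ n → IsNumber (natG n)
natG-isNumber zero    = (λ ()) , (λ ()) , (λ ())
natG-isNumber (suc n) = (λ _ → natG-isNumber n) , (λ ()) , (λ _ ())

neg-natG-isNumber : ∀ n → IsNumber (neg (natG n))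
neg-natG-isNumber zero    = (λ ()) , (λ ()) , (λ ())
neg-natG-isNumber (suc n) = (λ ()) , (λ _ → neg-natG-isNumber n) , (λ ())

canonZ-isNumber : ∀ K u → IsNumber (canonZ u K)
canonZ-isNumber zero (+ n)     = natG-isNumber n
canonZ-isNumber zero -[1+ n ]  = neg-natG-isNumber (suc n)
canonZ-isNumber (suc K) u with parity u
... | even w rewrite canonZ-even w K = canonZ-isNumber K w
... | odd w rewrite canonZ-odd w K =
  ⟨∣⟩-isNumber (canonZ-isNumber K w) (canonZ-isNumber K (w ℤ.+ 1ℤ)) (canonZ-⧏-suc K w)

canonZ-mono-≤ : ∀ K u d → canonZ u K ≤ canonZ (u ℤ.+ + d) K
canonZ-mono-< : ∀ K u d → canonZ u K ⧏ canonZ (u ℤ.+ + suc d) K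
canonZ-mono-≤ K u zero    = subst (λ v → canonZ u K ≤ canonZ v K) (sym (ℤ.+-identityʳ u)) (≤-refl _)
canonZ-mono-≤ K u (suc d) =
  number-⧏⇒≤ (canonZ-isNumber K u) (canonZ-isNumber K (u ℤ.+ + suc d)) (canonZ-mono-< K u d)
canonZ-mono-< K u d = ⧏-≤-trans (canonZ-⧏-suc K u)
  (subst (λ v → canonZ (u ℤ.+ 1ℤ) K ≤ canonZ v K) (ℤ.+-assoc u 1ℤ (+ d)) (canonZ-mono-≤ K (u ℤ.+ 1ℤ) d))

canonZ-+1≤Ro : ∀ K u → ∀ j → canonZ (u ℤ.+ 1ℤ) K ≤ Ro (canonZ u K) j
canonZ-+1≤Ro zero (+ zero)       = λ ()
canonZ-+1≤Ro zero (+ suc n)      = λ ()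
canonZ-+1≤Ro zero -[1+ zero ]    = λ _ → (λ ()) , (λ ())
canonZ-+1≤Ro zero -[1+ suc n ]   = λ _ → ≤-refl _
canonZ-+1≤Ro (suc K) u with parity u
... | even w rewrite canonZ-even w K | canonZ-odd w K =
  λ j → ≤-trans (number≤Ro _ (subst IsNumber (canonZ-odd w K) (canonZ-isNumber (suc K) (w ℤ.* + 2 ℤ.+ 1ℤ))) 0F) (canonZ-+1≤Ro K w j)
... | odd w rewrite canonZ-odd w K | canonZ-odd+1 w K = λ _ → ≤-refl _

Lo≤canonZ-1 : ∀ K u → ∀ i → Lo (canonZ u K) i ≤ canonZ (u ℤ.+ -1ℤ) K
Lo≤canonZ-1 zero (+ zero)    = λ ()
Lo≤canonZ-1 zero (+ suc n)   = λ _ → ≤-refl _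
Lo≤canonZ-1 zero -[1+ n ]    = λ ()
Lo≤canonZ-1 (suc K) u with parity u
... | even w rewrite canonZ-even w K | canonZ-even-1 w K =
  λ i → ≤-trans (Lo≤canonZ-1 K w i) (Lo≤number _ isLeftEnd 0F)
  where isLeftEnd = subst IsNumber (canonZ-even-1 w K) (canonZ-isNumber (suc K) (w ℤ.* + 2 ℤ.+ -1ℤ))
... | odd w rewrite canonZ-odd w K | canonZ-odd-1 w K = λ _ → ≤-refl _

-- Dyadic rationals up to value

pow2 : ℕ → ℤ
pow2 k = + (2 ^ k)

pow2-+ : ∀ k l → pow2 (k ℕ.+ l) ≡ pow2 k ℤ.* pow2 l
pow2-+ k l = trans (cong +_ (ℕ.^-distribˡ-+-* 2 k l)) (ℤ.pos-* (2 ^ k) (2 ^ l))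

pow2≡1+pred : ∀ k → pow2 k ≡ 1ℤ ℤ.+ + ℕ.pred (2 ^ k)
pow2≡1+pred k = cong +_ (sym (ℕ.suc-pred (2 ^ k) {{ℕ.m^n≢0 2 k}}))

canonZ-*pow2 : ∀ j x K → canonZ (x ℤ.* pow2 j) (K ℕ.+ j) ≡ canonZ x K
canonZ-*pow2 zero x K = cong₂ canonZ (ℤ.*-identityʳ x) (ℕ.+-identityʳ K)
canonZ-*pow2 (suc j) x K = begin
  canonZ (x ℤ.* pow2 (suc j)) (K ℕ.+ suc j)
    ≡⟨ cong₂ canonZ x*2^[1+j]≡x*2^j*2 (ℕ.+-suc K j) ⟩
  canonZ (x ℤ.* pow2 j ℤ.* + 2) (suc (K ℕ.+ j))
    ≡⟨ canonZ-even (x ℤ.* pow2 j) (K ℕ.+ j) ⟩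
  canonZ (x ℤ.* pow2 j) (K ℕ.+ j)
    ≡⟨ canonZ-*pow2 j x K ⟩
  canonZ x K ∎
  where
  open ≡-Reasoning
  x*2^[1+j]≡x*2^j*2 : x ℤ.* pow2 (suc j) ≡ x ℤ.* pow2 j ℤ.* + 2
  x*2^[1+j]≡x*2^j*2 = trans (cong (x ℤ.*_) (trans (pow2-+ 1 j) (ℤ.*-comm (+ 2) (pow2 j))))
                            (sym (ℤ.*-assoc x (pow2 j) (+ 2)))

infix 4 _≃D_
data _≃D_ : Dyadic → Dyadic → Set where
  *≡* : ∀ {a k b l} → a ℤ.* pow2 l ≡ b ℤ.* pow2 k → (a /2^ k) ≃D (b /2^ l)

≃D-sym : ∀ {x y} → x ≃D y → y ≃D x
≃D-sym (*≡* eq) = *≡* (sym eq)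

≃D-trans : ∀ {x y z} → x ≃D y → y ≃D z → x ≃D z
≃D-trans {a /2^ k} {b /2^ l} {c /2^ j} (*≡* a≃b) (*≡* b≃c) = *≡* (
  ℤ.*-cancelʳ-≡ (a ℤ.* pow2 j) (c ℤ.* pow2 k) (pow2 l) {{ℕ.m^n≢0 2 l}} (begin
    a ℤ.* pow2 j ℤ.* pow2 l ≡⟨ xy∙z≈xz∙y a (pow2 j) (pow2 l) ⟩
    a ℤ.* pow2 l ℤ.* pow2 j ≡⟨ cong (ℤ._* pow2 j) a≃b ⟩
    b ℤ.* pow2 k ℤ.* pow2 j ≡⟨ xy∙z≈xz∙y b (pow2 k) (pow2 j) ⟩
    b ℤ.* pow2 j ℤ.* pow2 k ≡⟨ cong (ℤ._* pow2 k) b≃c ⟩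
    c ℤ.* pow2 l ℤ.* pow2 k ≡⟨ xy∙z≈xz∙y c (pow2 l) (pow2 k) ⟩
    c ℤ.* pow2 k ℤ.* pow2 l ∎))
  where open ≡-Reasoning

/2^-expand : ∀ a k q {l} → q ℕ.+ k ≡ l → (a /2^ k) ≃D ((a ℤ.* pow2 q) /2^ l)
/2^-expand a k q refl = *≡* (trans (cong (a ℤ.*_) (pow2-+ q k)) (sym (ℤ.*-assoc a (pow2 q) (pow2 k))))

canon-cong : ∀ {x y} → x ≃D y → canon x ≡ canon y
canon-cong {a /2^ k} {b /2^ l} (*≡* a≃b) = begin
  canonZ a k                      ≡⟨ canonZ-*pow2 l a k ⟨
  canonZ (a ℤ.* pow2 l) (k ℕ.+ l) ≡⟨ cong₂ canonZ a≃b (ℕ.+-comm k l) ⟩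
  canonZ (b ℤ.* pow2 k) (l ℕ.+ k) ≡⟨ canonZ-*pow2 k b l ⟩
  canonZ b l                      ∎
  where open ≡-Reasoning

cross-multiplied-+-congˡ : ∀ a a′ c P Q R → a ℤ.* Q ≡ a′ ℤ.* P →
  (a ℤ.* R ℤ.+ c ℤ.* P) ℤ.* (Q ℤ.* R) ≡ (a′ ℤ.* R ℤ.+ c ℤ.* Q) ℤ.* (P ℤ.* R)
cross-multiplied-+-congˡ a a′ c P Q R aQ≡a′P = begin
  (a ℤ.* R ℤ.+ c ℤ.* P) ℤ.* (Q ℤ.* R)
    ≡⟨ solve (a ∷ c ∷ P ∷ Q ∷ R ∷ []) ⟩
  a ℤ.* Q ℤ.* (R ℤ.* R) ℤ.+ c ℤ.* (P ℤ.* Q ℤ.* R)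
    ≡⟨ cong (λ z → z ℤ.* (R ℤ.* R) ℤ.+ c ℤ.* (P ℤ.* Q ℤ.* R)) aQ≡a′P ⟩
  a′ ℤ.* P ℤ.* (R ℤ.* R) ℤ.+ c ℤ.* (P ℤ.* Q ℤ.* R)
    ≡⟨ solve (a′ ∷ c ∷ P ∷ Q ∷ R ∷ []) ⟩
  (a′ ℤ.* R ℤ.+ c ℤ.* Q) ℤ.* (P ℤ.* R) ∎
  where open ≡-Reasoning

+D-congˡ : ∀ {x x′} y → x ≃D x′ → (x +D y) ≃D (x′ +D y)
+D-congˡ {a /2^ k} {a′ /2^ l} (c /2^ j) (*≡* x≃x′) = *≡* (
  subst₂ (λ Q P → (a ℤ.* pow2 j ℤ.+ c ℤ.* pow2 k) ℤ.* Q ≡ (a′ ℤ.* pow2 j ℤ.+ c ℤ.* pow2 l) ℤ.* P)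
    (sym (pow2-+ l j)) (sym (pow2-+ k j))
    (cross-multiplied-+-congˡ a a′ c (pow2 k) (pow2 l) (pow2 j) x≃x′))

canon-+D-coarser : ∀ a c q p → canon ((a /2^ (q ℕ.+ p)) +D (c /2^ p)) ≡ canonZ (a ℤ.+ c ℤ.* pow2 q) (q ℕ.+ p)
canon-+D-coarser a c q p = begin
  canonZ (a ℤ.* pow2 p ℤ.+ c ℤ.* pow2 (q ℕ.+ p)) (q ℕ.+ p ℕ.+ p)
    ≡⟨ cong (λ z → canonZ (a ℤ.* pow2 p ℤ.+ c ℤ.* z) (q ℕ.+ p ℕ.+ p)) (pow2-+ q p) ⟩
  canonZ (a ℤ.* pow2 p ℤ.+ c ℤ.* (pow2 q ℤ.* pow2 p)) (q ℕ.+ p ℕ.+ p)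
    ≡⟨ cong (λ z → canonZ z (q ℕ.+ p ℕ.+ p)) (factor a c (pow2 q) (pow2 p)) ⟩
  canonZ ((a ℤ.+ c ℤ.* pow2 q) ℤ.* pow2 p) (q ℕ.+ p ℕ.+ p)
    ≡⟨ canonZ-*pow2 p (a ℤ.+ c ℤ.* pow2 q) (q ℕ.+ p) ⟩
  canonZ (a ℤ.+ c ℤ.* pow2 q) (q ℕ.+ p) ∎
  where
  open ≡-Reasoning
  factor : ∀ a c Q P → a ℤ.* P ℤ.+ c ℤ.* (Q ℤ.* P) ≡ (a ℤ.+ c ℤ.* Q) ℤ.* P
  factor = solve-∀

canonZ-u-2^[1+r]⧏u-1 : ∀ K u r → canonZ (u ℤ.+ -1ℤ ℤ.* pow2 (suc r)) K ⧏ canonZ (u ℤ.+ -1ℤ) K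
canonZ-u-2^[1+r]⧏u-1 K u r =
  subst (λ v → canonZ (u ℤ.+ -1ℤ ℤ.* pow2 (suc r)) K ⧏ canonZ v K) gap (canonZ-mono-< K _ (f ℕ.+ f))
  where
  open ≡-Reasoning
  f = ℕ.pred (2 ^ r)
  F = + f
  cancel : ∀ u F → u ℤ.+ -1ℤ ℤ.* (+ 2 ℤ.* (1ℤ ℤ.+ F)) ℤ.+ (1ℤ ℤ.+ (F ℤ.+ F)) ≡ u ℤ.+ -1ℤ
  cancel = solve-∀
  gap : u ℤ.+ -1ℤ ℤ.* pow2 (suc r) ℤ.+ + suc (f ℕ.+ f) ≡ u ℤ.+ -1ℤ
  gap = begin
    u ℤ.+ -1ℤ ℤ.* pow2 (suc r) ℤ.+ + suc (f ℕ.+ f)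
      ≡⟨ cong₂ (λ P D → u ℤ.+ -1ℤ ℤ.* P ℤ.+ D)
           (trans (pow2-+ 1 r) (cong (+ 2 ℤ.*_) (pow2≡1+pred r))) (cong (λ z → 1ℤ ℤ.+ z) (ℤ.pos-+ f f)) ⟩
    u ℤ.+ -1ℤ ℤ.* (+ 2 ℤ.* (1ℤ ℤ.+ F)) ℤ.+ (1ℤ ℤ.+ (F ℤ.+ F))
      ≡⟨ cancel u F ⟩
    u ℤ.+ -1ℤ ∎

-- Position of m relative to the grid 2^-p ℤ

data GridPosition (p : ℕ) (m : Dyadic) : Set where
  onGrid  : ∀ b → m ≃D (b /2^ p) → GridPosition p m
  offGrid : ∀ t r → m ≃D ((t ℤ.* + 2 ℤ.+ 1ℤ) /2^ (suc r ℕ.+ p)) → GridPosition p m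

GridPosition-resp : ∀ {p m m′} → m′ ≃D m → GridPosition p m → GridPosition p m′
GridPosition-resp m′≃m (onGrid b m≃)    = onGrid b (≃D-trans m′≃m m≃)
GridPosition-resp m′≃m (offGrid t r m≃) = offGrid t r (≃D-trans m′≃m m≃)

gridPosition : ∀ p k a → GridPosition p (a /2^ k)
gridPosition p k a with k ℕ.≤? p
... | yes k≤p with ℕ.m≤n⇒∃[o]m+o≡n k≤p
...   | q , k+q≡p = onGrid (a ℤ.* pow2 q) (/2^-expand a k q (trans (ℕ.+-comm q k) k+q≡p))
gridPosition p zero    a | no 0≰p = ⊥-elim (0≰p z≤n)
gridPosition p (suc k) a | no 1+k≰p with parity a
... | even w = GridPosition-resp (≃D-sym (/2^-expand w k 1 refl)) (gridPosition p k w)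
... | odd t with ℕ.m≤n⇒∃[o]m+o≡n (ℕ.≤-pred (ℕ.≰⇒> 1+k≰p))
...   | r , refl = offGrid t r (*≡* (cong (λ e → (t ℤ.* + 2 ℤ.+ 1ℤ) ℤ.* pow2 (suc e)) (ℕ.+-comm r p)))

canon-onGrid-+D : ∀ {m b p} → m ≃D (b /2^ p) → ∀ c → canon (m +D (c /2^ p)) ≡ canonZ (b ℤ.+ c) p
canon-onGrid-+D {m} {b} {p} m≃b c = begin
  canon (m +D (c /2^ p))         ≡⟨ canon-cong (+D-congˡ (c /2^ p) m≃b) ⟩
  canon ((b /2^ p) +D (c /2^ p)) ≡⟨ canon-+D-coarser b c 0 p ⟩
  canonZ (b ℤ.+ c ℤ.* pow2 0) p  ≡⟨ cong (λ z → canonZ (b ℤ.+ z) p) (ℤ.*-identityʳ c) ⟩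
  canonZ (b ℤ.+ c) p             ∎
  where open ≡-Reasoning

module _ {m : Dyadic} {b : ℤ} {p : ℕ} (m≃b : m ≃D (b /2^ p)) where

  ball-onGrid : ball m (negPow p) ≡ ⟨ canonZ (b ℤ.+ -1ℤ) p ∣ canonZ (b ℤ.+ 1ℤ) p ⟩
  ball-onGrid = cong₂ ⟨_∣_⟩ (canon-onGrid-+D m≃b -1ℤ) (canon-onGrid-+D m≃b 1ℤ)

  ball-onGrid-suc : ball m (negPow (suc p))
    ≡ ⟨ ⟨ canonZ (b ℤ.+ -1ℤ) p ∣ canonZ b p ⟩ ∣ ⟨ canonZ b p ∣ canonZ (b ℤ.+ 1ℤ) p ⟩ ⟩
  ball-onGrid-suc = cong₂ ⟨_∣_⟩
    (trans (canon-onGrid-+D m≃2b -1ℤ) (canonZ-even-1 b p))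
    (trans (canon-onGrid-+D m≃2b 1ℤ) (canonZ-odd b p))
    where m≃2b = ≃D-trans m≃b (/2^-expand b p 1 refl)

  onGrid-step : HalvingStep (ball m (negPow p)) (ball m (negPow (suc p))) (canon m)
  onGrid-step =
    subst₂ (λ G H → HalvingStep G H (canon m)) (sym ball-onGrid) (sym ball-onGrid-suc)
      (subst (HalvingStep ⟨ ℓ ∣ ρ ⟩ ⟨ ⟨ ℓ ∣ μ ⟩ ∣ ⟨ μ ∣ ρ ⟩ ⟩) (sym (canon-cong m≃b))
        (split-ball (canonZ-isNumber p _) (canonZ-isNumber p b) (canonZ-isNumber p _)
          (subst (λ v → ℓ ⧏ canonZ v p) (w-1+1≡w b) (canonZ-⧏-suc p (b ℤ.+ -1ℤ)))
          (canonZ-⧏-suc p b) (Lo≤canonZ-1 p b) (canonZ-+1≤Ro p b)))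
    where
    ℓ = canonZ (b ℤ.+ -1ℤ) p
    μ = canonZ b p
    ρ = canonZ (b ℤ.+ 1ℤ) p

offGrid-unbalanced : ∀ {m p} t r → m ≃D ((t ℤ.* + 2 ℤ.+ 1ℤ) /2^ (suc r ℕ.+ p)) →
  ¬ BalancedAt (ball m (negPow p)) (canon m)
offGrid-unbalanced {m} {p} t r m≃a balanced =
  off-centre gA⧏X (canonZ-+1≤Ro K t)
    (balanced⇒≈ _ _ isBall isμ (subst₂ BalancedAt ball-m canon-m balanced))
  where
  K = r ℕ.+ p
  a = t ℤ.* + 2 ℤ.+ 1ℤ
  gA = canonZ (a ℤ.+ -1ℤ ℤ.* pow2 (suc r)) (suc K)
  gB = canonZ (a ℤ.+ 1ℤ ℤ.* pow2 (suc r)) (suc K)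
  μ = ⟨ canonZ t K ∣ canonZ (t ℤ.+ 1ℤ) K ⟩

  canon-m : canon m ≡ μ
  canon-m = trans (canon-cong m≃a) (canonZ-odd t K)

  ball-m : ball m (negPow p) ≡ ⟨ gA ∣ gB ⟩
  ball-m = cong₂ ⟨_∣_⟩
    (trans (canon-cong (+D-congˡ (-1ℤ /2^ p) m≃a)) (canon-+D-coarser a -1ℤ (suc r) p))
    (trans (canon-cong (+D-congˡ (1ℤ /2^ p) m≃a)) (canon-+D-coarser a 1ℤ (suc r) p))

  isμ : IsNumber μ
  isμ = subst IsNumber (canonZ-odd t K) (canonZ-isNumber (suc K) a)

  gA⧏X : gA ⧏ canonZ t K
  gA⧏X = subst (gA ⧏_) (canonZ-odd-1 t K) (canonZ-u-2^[1+r]⧏u-1 (suc K) a r)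

  μ≤gB : μ ≤ gB
  μ≤gB = subst₂ _≤_ (canonZ-odd t K)
    (cong (λ z → canonZ (a ℤ.+ z) (suc K)) (sym (ℤ.*-identityˡ (pow2 (suc r)))))
    (canonZ-mono-≤ (suc K) a (2 ^ suc r))

  isBall : IsNumber ⟨ gA ∣ gB ⟩
  isBall = ⟨∣⟩-isNumber (canonZ-isNumber (suc K) (a ℤ.+ -1ℤ ℤ.* pow2 (suc r)))
                        (canonZ-isNumber (suc K) (a ℤ.+ 1ℤ ℤ.* pow2 (suc r)))
    (⧏-≤-trans gA⧏X (≤-trans (Lo≤number μ isμ 0F) μ≤gB))

lemma3p3 : (m : Dyadic) (p : ℕ) →
    Balanced m (negPow p) →
    ((ball m (negPow p) ∶ zeroU) ≜ ball m (negPow (suc p))) × Balanced m (negPow (suc p))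
lemma3p3 (a /2^ k) p with gridPosition p k a
... | onGrid b m≃b      = onGrid-step m≃b
... | offGrid t r m≃odd = λ balanced → ⊥-elim (offGrid-unbalanced t r m≃odd balanced)
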